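{- Let $n$ be even and let $f:\{0,1\}^n\to\{0,1\}$ be the Boolean function represented by the read-once DNF formula $t_1\vee t_2\vee\dots\vee t_{n/2}$, where $t_i=x_i x_{n/2+i}$. Then the $Q$-value of $f$ is at least $2^{n/2}$.
   Context: A partial assignment is $b\in\{0,1,*\}^n$. For partial assignments $a,b$, $a\sim b$ means $a_i=b_i$ whenever $b_i\ne *$. For $l\in\{0,1\}$, $b_{x_i\leftarrow l}$ is $b$ with its $i$-th coordinate set to $l$. $b$ is a $0$-certificate ($1$-certificate) of $f$ if $f(a)=0$ ($f(a)=1$) for all $a\in\{0,1\}^n$ with $a\sim b$. A utility function $g:\{0,1,*\}^n\to\mathbb{Z}_{\ge0}$ is monotone if $g(b_{x_i\leftarrow l})\ge g(b)$ whenever $b_i=*$, $l\in\{0,1\}$; submodular if $g(b_{x_i\leftarrow l})-g(b)\ge g(b'_{x_i\leftarrow l})-g(b')$ whenever $b'\sim b$, $b_i=b'_i=*$, $l\in\{0,1\}$. $g$ is assignment feasible for $f$ with goal value $Q$ if $g$ is monotone and submodular, $g(*,\dots,*)=0$, and for all $b$, $g(b)=Q$ iff $b$ is a $0$-certificate or a $1$-certificate of $f$. The $Q$-value of $f$ is the minimum integer $Q$ such that some integer-valued utility function is assignment feasible for $f$ with goal value $Q$. -}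

module Defs where

open import Data.Nat using (ℕ; _+_; _≤_)
open import Data.Bool using (Bool; true; false; _∧_; if_then_else_)
open import Data.Maybe using (Maybe; just; nothing)
open import Data.Fin using (Fin; _↑ˡ_; _↑ʳ_; _≟_)
open import Data.List using (allFin)
open import Data.Bool.ListAction using (any)
open import Data.Sum using (_⊎_)
open import Data.Product using (_×_)
open import Relation.Nullary using (¬_; does)
open import Relation.Binary.PropositionalEquality using (_≡_)

Assignment : ℕ → Set
Assignment n = Fin n → Bool

-- Partial assignments in {0,1,*}^n ; nothing = *.
Partial : ℕ → Set
Partial n = Fin n → Maybe Bool

allStar : ∀ {n} → Partial n
allStar _ = nothing

_∼_ : ∀ {n} → Assignment n → Partial n → Set
a ∼ b = ∀ i c → b i ≡ just c → a i ≡ c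

_∼ₚ_ : ∀ {n} → Partial n → Partial n → Set
b' ∼ₚ b = ∀ i c → b i ≡ just c → b' i ≡ just c

set : ∀ {n} → Partial n → Fin n → Bool → Partial n
set b i l j = if does (j ≟ i) then just l else b j

IsCertificate : ∀ {n} → (Assignment n → Bool) → Bool → Partial n → Set
IsCertificate f v b = ∀ a → a ∼ b → f a ≡ v

Monotone : ∀ {n} → (Partial n → ℕ) → Set
Monotone g = ∀ b i l → b i ≡ nothing → g b ≤ g (set b i l)

-- g(b_{i←l}) - g(b) ≥ g(b'_{i←l}) - g(b'), written without subtraction.
Submodular : ∀ {n} → (Partial n → ℕ) → Set
Submodular g = ∀ b b' i l → b' ∼ₚ b → b i ≡ nothing → b' i ≡ nothing →
  g (set b' i l) + g b ≤ g (set b i l) + g b'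

_⟺_ : Set → Set → Set
P ⟺ Q = (P → Q) × (Q → P)

IsCert : ∀ {n} → (Assignment n → Bool) → Partial n → Set
IsCert f b = IsCertificate f false b ⊎ IsCertificate f true b

AssignmentFeasible : ∀ {n} → (Assignment n → Bool) → (Partial n → ℕ) → ℕ → Set
AssignmentFeasible f g Q =
  Monotone g × Submodular g × g allStar ≡ 0 ×
  (∀ b → (g b ≡ Q) ⟺ IsCert f b)

-- The read-once DNF  t_1 ∨ … ∨ t_k  with t_i = x_i x_{k+i}, on n = k + k variables.
-- Index i : Fin k ↦ x_i is (i ↑ˡ k), x_{k+i} is (k ↑ʳ i).
readOnceDNF : (k : ℕ) → Assignment (k + k) → Bool
readOnceDNF k a = any (λ i → a (i ↑ˡ k) ∧ a (k ↑ʳ i)) (allFin k)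

-- Call b a frontier for a set S of terms when every term of S is completely unassigned and
-- every other term has a literal fixed to 0.  For feasible g with goal Q and S nonempty,
-- g b + 2^|S| ≤ Q.  Take t ∈ S with literals x, y: fixing both to 1 gives a 1-certificate, so
-- submodularity gives Q + g b ≤ g(b_{x←1}) + g(b_{y←1}).  By monotonicity g(b_{x←1}) is at most
-- the value of the frontier for S ∖ {t} obtained by also fixing y to 0, which by induction is at
-- most Q − 2^{|S|−1}; if S = {t} that frontier is a 0-certificate while b_{x←1} is not a
-- certificate, so g(b_{x←1}) ≤ Q − 1.  The all-* assignment is a frontier for all n/2 terms.
module Submission where

open import Defs
open import Data.Nat using (ℕ; suc; _+_; _*_; _≤_; _<_; _^_)
open import Data.Nat.Properties
  using (≤-trans; ≤-reflexive; ≤∧≢⇒<; +-comm; +-mono-≤; +-monoˡ-≤; +-cancelˡ-≤; module ≤-Reasoning)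
open import Data.Nat.Solver using (module +-*-Solver)
open import Data.Bool using (Bool; true; false; not; T; _∧_)
open import Data.Bool.Properties using (T-≡; T-∧; ¬-not; not-¬)
open import Data.Maybe using (just; nothing; fromMaybe)
open import Data.Fin using (Fin; _↑ˡ_; _↑ʳ_; splitAt; _≟_)
open import Data.Fin.Properties using (↑ˡ-injective; ↑ʳ-injective; splitAt-↑ˡ; splitAt-↑ʳ)
open import Data.List using (List; []; _∷_; allFin; length)
open import Data.List.Properties using (length-tabulate)
open import Data.List.Membership.Propositional using (_∈_; lose)
open import Data.List.Membership.Propositional.Properties using (∈-allFin)
open import Data.List.Relation.Unary.Any using (here; there; satisfied)
open import Data.List.Relation.Unary.Any.Properties using (any⁺; any⁻)
open import Data.List.Relation.Unary.All as All using ()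
open import Data.List.Relation.Unary.AllPairs as AllPairs using ()
open import Data.List.Relation.Unary.Unique.Propositional using (Unique)
open import Data.List.Relation.Unary.Unique.Propositional.Properties using (allFin⁺)
open import Data.Sum using (_⊎_; inj₁; inj₂; [_,_]′)
open import Data.Product using (_×_; _,_; proj₁; proj₂; ∃)
open import Function using (_∘_; id; Equivalence)
open import Relation.Nullary using (¬_; yes; no; contradiction)
open import Relation.Binary.PropositionalEquality

open Equivalence using (to; from)

set-same : ∀ {n} (b : Partial n) i l → set b i l i ≡ just l
set-same b i l with i ≟ i
... | yes _ = refl
... | no i≢i = contradiction refl i≢i

set-other : ∀ {n} (b : Partial n) {i} l {j} → j ≢ i → set b i l j ≡ b j
set-other b {i} l {j} j≢i with j ≟ i
... | yes j≡i = contradiction j≡i j≢i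
... | no _ = refl

set-extends : ∀ {n} (b : Partial n) i l → b i ≡ nothing → set b i l ∼ₚ b
set-extends b i l bi≡* j c bj≡c with j ≟ i
... | yes refl = contradiction (trans (sym bi≡*) bj≡c) λ ()
... | no _ = bj≡c

∼ₚ-trans : ∀ {n} {b₁ b₂ b₃ : Partial n} → b₃ ∼ₚ b₂ → b₂ ∼ₚ b₁ → b₃ ∼ₚ b₁
∼ₚ-trans b₃∼b₂ b₂∼b₁ i c = b₃∼b₂ i c ∘ b₂∼b₁ i c

fill : ∀ {n} → Bool → Partial n → Assignment n
fill l b j = fromMaybe l (b j)

fill-∼ : ∀ {n} l (b : Partial n) → fill l b ∼ b
fill-∼ l b i c bi≡c rewrite bi≡c = refl

fill-∼-set : ∀ {n} l {b : Partial n} {v} → b v ≡ nothing → fill l b ∼ set b v l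
fill-∼-set l {b} {v} bv≡* i c eq with i ≟ v
... | yes refl rewrite bv≡* = just-injective eq
  where just-injective : ∀ {x y : Bool} → just x ≡ just y → x ≡ y
        just-injective refl = refl
... | no _ = fill-∼ l b i c eq

¬IsCert-split : ∀ {n} {f : Assignment n → Bool} {b : Partial n} {v} → b v ≡ nothing →
  IsCertificate f false (set b v false) → IsCertificate f true (set b v true) → ¬ IsCert f b
¬IsCert-split {b = b} bv≡* cert₀ cert₁ (inj₁ b-cert₀) =
  contradiction (trans (sym (b-cert₀ _ (fill-∼ true b))) (cert₁ _ (fill-∼-set true bv≡*))) λ ()
¬IsCert-split {b = b} bv≡* cert₀ cert₁ (inj₂ b-cert₁) =
  contradiction (trans (sym (b-cert₁ _ (fill-∼ false b))) (cert₀ _ (fill-∼-set false bv≡*))) λ ()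

module AssignmentFeasibility {n} {f : Assignment n → Bool} {g : Partial n → ℕ} {Q : ℕ}
  (feasible : AssignmentFeasible f g Q) where

  monotone : Monotone g
  monotone = proj₁ feasible

  goal-at-certificate : ∀ {b} → IsCert f b → g b ≡ Q
  goal-at-certificate = proj₂ (proj₂ (proj₂ (proj₂ feasible)) _)

  below-goal : ∀ {b b'} → g b ≤ g b' → IsCert f b' → ¬ IsCert f b → g b < Q
  below-goal gb≤gb' b'-cert b-not-cert = ≤∧≢⇒<
    (≤-trans gb≤gb' (≤-reflexive (goal-at-certificate b'-cert)))
    (b-not-cert ∘ proj₁ (proj₂ (proj₂ (proj₂ feasible)) _))

  submodular-at-certificate : ∀ {b i j} l l' → b i ≡ nothing → b j ≡ nothing → j ≢ i →
    IsCert f (set (set b i l) j l') → Q + g b ≤ g (set b j l') + g (set b i l)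
  submodular-at-certificate {b} {i} {j} l l' bi≡* bj≡* j≢i cert =
    subst (λ q → q + g b ≤ _) (goal-at-certificate cert)
      (proj₁ (proj₂ feasible) b (set b i l) j l' (set-extends b i l bi≡*) bj≡*
        (trans (set-other b l j≢i) bj≡*))

double-bound : ∀ {Q a x y p} → Q + a ≤ x + y → x + p ≤ Q → y + p ≤ Q → a + 2 * p ≤ Q
double-bound {Q} {a} {x} {y} {p} Q+a≤x+y x+p≤Q y+p≤Q = +-cancelˡ-≤ Q _ _ (begin
  Q + (a + 2 * p)     ≡⟨ solve 3 (λ Q a p → Q :+ (a :+ con 2 :* p) := (Q :+ a) :+ (p :+ p)) refl Q a p ⟩
  (Q + a) + (p + p)   ≤⟨ +-monoˡ-≤ (p + p) Q+a≤x+y ⟩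
  (x + y) + (p + p)   ≡⟨ solve 3 (λ x y p → (x :+ y) :+ (p :+ p) := (x :+ p) :+ (y :+ p)) refl x y p ⟩
  (x + p) + (y + p)   ≤⟨ +-mono-≤ x+p≤Q y+p≤Q ⟩
  Q + Q               ∎)
  where open ≤-Reasoning
        open +-*-Solver

module ReadOnceDNF (k : ℕ) where

  f : Assignment (k + k) → Bool
  f = readOnceDNF k

  -- literal true i is x_i and literal false i is x_{k+i}.
  literal : Bool → Fin k → Fin (k + k)
  literal true i = i ↑ˡ k
  literal false i = k ↑ʳ i

  literal-injective : ∀ s s' i j → literal s i ≡ literal s' j → s ≡ s' × i ≡ j
  literal-injective true true i j eq = refl , ↑ˡ-injective k i j eq
  literal-injective false false i j eq = refl , ↑ʳ-injective k i j eq
  literal-injective true false i j eq =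
    contradiction (trans (sym (splitAt-↑ˡ k i k)) (trans (cong (splitAt k) eq) (splitAt-↑ʳ k k j))) λ ()
  literal-injective false true i j eq =
    contradiction (trans (sym (splitAt-↑ʳ k k i)) (trans (cong (splitAt k) eq) (splitAt-↑ˡ k j k))) λ ()

  term : Assignment (k + k) → Fin k → Bool
  term a i = a (literal true i) ∧ a (literal false i)

  Falsified : Partial (k + k) → Fin k → Set
  Falsified b i = ∃ λ s → b (literal s i) ≡ just false

  falsified-extends : ∀ {b b' i} → b' ∼ₚ b → Falsified b i → Falsified b' i
  falsified-extends b'∼b (s , bs≡0) = s , b'∼b _ false bs≡0

  all-falsified-certificate : ∀ {b} → (∀ i → Falsified b i) → IsCertificate f false b
  all-falsified-certificate {b} falsified a a∼b =
    ¬-not (term-false ∘ satisfied ∘ any⁻ (term a) (allFin k) ∘ from T-≡)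
    where literal-holds : ∀ {i} s → T (a (literal true i)) × T (a (literal false i)) →
                            T (a (literal s i))
          literal-holds true = proj₁
          literal-holds false = proj₂

          term-false : ¬ ∃ (T ∘ term a)
          term-false (i , holds) with falsified i
          ... | s , bs≡0 = subst T (a∼b _ false bs≡0) (literal-holds s (to T-∧ holds))

  term-certificate : ∀ {b t} s → b (literal s t) ≡ just true → b (literal (not s) t) ≡ just true →
    IsCertificate f true b
  term-certificate {b} {t} s bs≡1 b¬s≡1 a a∼b =
    to T-≡ (any⁺ (term a) (lose (∈-allFin t)
      (from T-∧ (both s (a∼b _ true bs≡1) (a∼b _ true b¬s≡1)))))
    where both : ∀ s → a (literal s t) ≡ true → a (literal (not s) t) ≡ true →
                   T (a (literal true t)) × T (a (literal false t))
          both true x y = from T-≡ x , from T-≡ y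
          both false x y = from T-≡ y , from T-≡ x

  literal-not≢ : ∀ s t → literal (not s) t ≢ literal s t
  literal-not≢ s t eq = not-¬ refl (sym (proj₁ (literal-injective (not s) s t t eq)))

  partner-unassigned : ∀ b t s l → b (literal (not s) t) ≡ nothing →
    set b (literal s t) l (literal (not s) t) ≡ nothing
  partner-unassigned b t s l b¬s≡* = trans (set-other b l (literal-not≢ s t)) b¬s≡*

  both-true-certificate : ∀ {b t} s → b (literal (not s) t) ≡ nothing →
    IsCertificate f true (set (set b (literal s t) true) (literal (not s) t) true)
  both-true-certificate {b} {t} s b¬s≡* = term-certificate s
    (set-extends b₁ (literal (not s) t) true (partner-unassigned b t s true b¬s≡*) _ true
      (set-same b (literal s t) true))
    (set-same b₁ (literal (not s) t) true)
    where b₁ : Partial (k + k)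
          b₁ = set b (literal s t) true

  record Frontier (b : Partial (k + k)) (S : List (Fin k)) : Set where
    field
      distinct : Unique S
      unassigned : ∀ {i} → i ∈ S → ∀ s → b (literal s i) ≡ nothing
      covered : ∀ i → i ∈ S ⊎ Falsified b i

  open Frontier public

  frontier-allStar : Frontier allStar (allFin k)
  frontier-allStar = record
    { distinct = allFin⁺ k ; unassigned = λ _ _ → refl ; covered = inj₁ ∘ ∈-allFin }

  frontier-[]-certificate : ∀ {b} → Frontier b [] → IsCertificate f false b
  frontier-[]-certificate fr = all-falsified-certificate λ i → [ (λ ()) , id ]′ (covered fr i)

  frontier-partner-unassigned : ∀ b t s {L} → Frontier b (t ∷ L) →
    set b (literal s t) true (literal (not s) t) ≡ nothing
  frontier-partner-unassigned b t s fr = partner-unassigned b t s true (unassigned fr (here refl) (not s))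

  close : Partial (k + k) → Fin k → Bool → Partial (k + k)
  close b t s = set (set b (literal s t) true) (literal (not s) t) false

  frontier-close : ∀ {b t L} s → Frontier b (t ∷ L) → Frontier (close b t s) L
  frontier-close {b} {t} {L} s fr = record
    { distinct = AllPairs.tail (distinct fr) ; unassigned = unassigned′ ; covered = covered′ }
    where
    close-extends : close b t s ∼ₚ b
    close-extends = ∼ₚ-trans
      (set-extends (set b (literal s t) true) (literal (not s) t) false
        (frontier-partner-unassigned b t s fr))
      (set-extends b (literal s t) true (unassigned fr (here refl) s))

    unassigned′ : ∀ {i} → i ∈ L → ∀ s' → close b t s (literal s' i) ≡ nothing
    unassigned′ {i} i∈L s' =
      trans (set-other (set b (literal s t) true) false (differs (not s)))
        (trans (set-other b true (differs s)) (unassigned fr (there i∈L) s'))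
      where differs : ∀ s → literal s' i ≢ literal s t
            differs s eq =
              All.lookup (AllPairs.head (distinct fr)) i∈L (sym (proj₂ (literal-injective s' s i t eq)))

    covered′ : ∀ i → i ∈ L ⊎ Falsified (close b t s) i
    covered′ i with covered fr i
    ... | inj₁ (here refl) = inj₂ (not s , set-same (set b (literal s t) true) (literal (not s) t) false)
    ... | inj₁ (there i∈L) = inj₁ i∈L
    ... | inj₂ falsified = inj₂ (falsified-extends close-extends falsified)

module FrontierBound {k g Q} (feasible : AssignmentFeasible (readOnceDNF k) g Q) where
  open ReadOnceDNF k
  open AssignmentFeasibility feasible

  mutual
    frontier-bound : ∀ {b t L} → Frontier b (t ∷ L) → g b + 2 ^ length (t ∷ L) ≤ Q
    frontier-bound {b} {t} {L} fr = double-bound {p = 2 ^ length L}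
      (submodular-at-certificate true true (t-unassigned true) (t-unassigned false)
        (literal-not≢ true t) (inj₂ (both-true-certificate true (t-unassigned false))))
      (literal-bound false fr)
      (literal-bound true fr)
      where t-unassigned : ∀ s → b (literal s t) ≡ nothing
            t-unassigned = unassigned fr (here refl)

    literal-bound : ∀ {b t L} s → Frontier b (t ∷ L) → g (set b (literal s t) true) + 2 ^ length L ≤ Q
    literal-bound {b} {t} {[]} s fr = subst (_≤ Q) (+-comm 1 _) (below-goal
      (monotone _ (literal (not s) t) false (frontier-partner-unassigned b t s fr))
      (inj₁ closed-certificate)
      (¬IsCert-split (frontier-partner-unassigned b t s fr) closed-certificate
        (both-true-certificate s (unassigned fr (here refl) (not s)))))
      where closed-certificate : IsCertificate f false (close b t s)
            closed-certificate = frontier-[]-certificate (frontier-close s fr)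
    literal-bound {b} {t} {_ ∷ _} s fr = ≤-trans
      (+-monoˡ-≤ _ (monotone _ (literal (not s) t) false (frontier-partner-unassigned b t s fr)))
      (frontier-bound (frontier-close s fr))

theorem2 : (k : ℕ) → 1 ≤ k → (g : Partial (k + k) → ℕ) → (Q : ℕ) →
    AssignmentFeasible (readOnceDNF k) g Q → 2 ^ k ≤ Q
theorem2 (suc k) _ g Q feasible =
  subst (_≤ Q) (cong₂ (λ x n → x + 2 ^ n) g-allStar≡0 (length-tabulate {n = suc k} id))
    (frontier-bound frontier-allStar)
  where open ReadOnceDNF (suc k)
        open FrontierBound feasible
        g-allStar≡0 : g allStar ≡ 0
        g-allStar≡0 = proj₁ (proj₂ (proj₂ feasible))
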